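{- For every $k\in\mathbb N$ with $n^{1/k}\in\mathbb N$, the algorithm $ACC_k$ described below solves the $n$-Interval problem: for every element $x\in\mathcal U$ and all $i\le j\le n$, its answer to BlockIntervalQuery$(x,i,j)$ equals $g_x^{i,j}$ exactly.
   Context: Block setting: elements come from a universe $\mathcal U$; a block algorithm processes a stream of blocks (each block is a set of elements; each element is added at most once to a given block) via ADD$(x)$ (add $x$ to the newest block) and ENDBLOCK() (a new empty block becomes the newest one). For $w\le n$, $g_x^w$ is the number of blocks among the last $w$ blocks that contain $x$, and $g_x^{i,j}=g_x^j-g_x^i$ for $i\le j\le n$. Algorithm $ACC_k$: let $d=n^{1/k}$. The block stream is partitioned into consecutive frames of $n$ blocks. Within a frame, each block is a level-0 segment, and for $1\le\ell\le k$ a level-$\ell$ segment consists of $d$ consecutive level-$(\ell-1)$ segments (the level-$k$ segment is the whole frame). For each $\ell\in\{0,\ldots,k-1\}$, when a level-$\ell$ segment ends, the algorithm stores a level-$\ell$ table recording, for each element, the number of blocks containing it from the beginning of the enclosing level-$(\ell+1)$ segment up to the end of this segment. It keeps $k$ incomplete tables with the same cumulative counts for segments that have started but not ended (each ADD$(x)$ increments $x$'s entry in all of them), and ghost tables retaining, for each level, the most recently overwritten table of that level from the previous frame. A query WinQuery$(x,w)$ returns $g_x^w$ computed as follows: the frequency of $x$ from the beginning of the current frame to the present is obtained by summing the incomplete level-0 count with the tables of the largest completed segments covering the frame prefix; if the $w$ most recent blocks lie within the current frame, the cumulative frequency before the window's first block (obtained from tables in the same way) is subtracted; otherwise, the frequency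 of $x$ in the previous frame (from its top-level table) is added and the cumulative frequency in the previous frame before the window's first block, obtained from the stored tables or, where those have been overwritten, from the ghost tables, is subtracted. BlockIntervalQuery$(x,i,j)$ returns WinQuery$(x,j)$ if $i=0$ and WinQuery$(x,j)-$WinQuery$(x,i)$ otherwise. -}

module Defs where

open import Data.Nat using (ℕ; zero; suc; _+_; _*_; _∸_; _^_; _≤ᵇ_; _<ᵇ_; _≡ᵇ_)
open import Data.Nat.DivMod using (_/_; _%_)
open import Data.Bool using (Bool; true; false; if_then_else_; _∧_)
open import Data.List using (List; []; _∷_; foldl; take)
open import Relation.Nullary.Decidable using (⌊_⌋)
open import Relation.Binary.Definitions using (DecidableEquality)

data Op (U : Set) : Set where
  add      : U → Op U
  endblock : Op U

-- The blocks seen so far, NEWEST FIRST.  Initially there is one (empty)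
-- newest block; the newest block is the one currently being filled.
blockStep : {U : Set} → List (List U) → Op U → List (List U)
blockStep []       (add x)  = (x ∷ []) ∷ []
blockStep (b ∷ bs) (add x)  = (x ∷ b) ∷ bs
blockStep bs       endblock = [] ∷ bs

blocks : {U : Set} → List (Op U) → List (List U)
blocks ops = foldl blockStep ([] ∷ []) ops

module _ {U : Set} (_≟_ : DecidableEquality U) where

  mem : U → List U → Bool
  mem x []       = false
  mem x (y ∷ ys) = if ⌊ x ≟ y ⌋ then true else mem x ys

  countBlocks : U → List (List U) → ℕ
  countBlocks x []       = 0
  countBlocks x (b ∷ bs) = (if mem x b then 1 else 0) + countBlocks x bs

  g : U → ℕ → List (Op U) → ℕ
  g x w ops = countBlocks x (take w (blocks ops))

  gInt : U → ℕ → ℕ → List (Op U) → ℕ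
  gInt x i j ops = g x j ops ∸ g x i ops

-- total division / remainder (divisor 0 never occurs under the hypotheses)
_div_ : ℕ → ℕ → ℕ
m div zero  = 0
m div suc n = m / suc n

_mod_ : ℕ → ℕ → ℕ
m mod zero  = m
m mod suc n = m % suc n

sumBelow : ℕ → (ℕ → ℕ) → ℕ
sumBelow zero    f = 0
sumBelow (suc m) f = sumBelow m f + f m

record State (U : Set) : Set where
  field
    pos   : ℕ                 -- index (0..n-1) of the newest block within the current frame
    inc   : ℕ → U → ℕ         -- incomplete level-ℓ tables, ℓ < k
    tab   : ℕ → ℕ → U → ℕ     -- tab ℓ s : stored level-ℓ table of the s-th level-ℓ segment of the frame
    ghost : ℕ → U → ℕ         -- ghost ℓ : most recently overwritten level-ℓ table (of the previous frame)

module ACC {U : Set} (_≟_ : DecidableEquality U) (d k : ℕ) where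

  n : ℕ
  n = d ^ k

  init : State U
  init = record { pos = 0 ; inc = λ _ _ → 0 ; tab = λ _ _ _ → 0 ; ghost = λ _ _ → 0 }

  bump : (U → ℕ) → U → U → ℕ
  bump f x y = if ⌊ y ≟ x ⌋ then suc (f y) else f y

  -- level-ℓ segment ends with the block at frame position p
  ends : ℕ → ℕ → Bool
  ends ℓ p = (suc p mod (d ^ ℓ)) ≡ᵇ 0

  -- digit ℓ of q in base d : position of q's level-ℓ segment in its parent
  digit : ℕ → ℕ → ℕ
  digit ℓ q = (q div (d ^ ℓ)) mod d

  -- index (within the frame) of the level-ℓ segment immediately preceding q's
  idx : ℕ → ℕ → ℕ
  idx ℓ q = (q div (d ^ ℓ)) ∸ 1

  ADD : State U → U → State U
  ADD s x = record s { inc = λ ℓ → if ℓ <ᵇ k then bump (State.inc s ℓ) x else State.inc s ℓ }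

  ENDBLOCK : State U → State U
  ENDBLOCK s = record
      { pos   = suc p mod n
      ; inc   = λ ℓ → if ends (suc ℓ) p then (λ _ → 0) else inc ℓ
      ; tab   = λ ℓ t → if (ℓ <ᵇ k) ∧ ends ℓ p ∧ (t ≡ᵇ idx ℓ (suc p)) then inc ℓ else tab ℓ t
      ; ghost = λ ℓ → if (ℓ <ᵇ k) ∧ ends ℓ p then tab ℓ (idx ℓ (suc p)) else ghost ℓ
      }
    where
      open State s
      p = pos

  step : State U → Op U → State U
  step s (add x)  = ADD s x
  step s endblock = ENDBLOCK s

  run : List (Op U) → State U
  run ops = foldl step init ops

  module _ (s : State U) (x : U) where
    open State s

    -- frequency of x from the beginning of the current frame to the present
    prefix : ℕ
    prefix = inc 0 x + sumBelow (k ∸ 1) (λ m →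
               if 1 ≤ᵇ digit (suc m) pos then tab (suc m) (idx (suc m) pos) x else 0)

    -- cumulative frequency in the current frame before block q
    cumCur : ℕ → ℕ
    cumCur q = sumBelow k (λ ℓ → if 1 ≤ᵇ digit ℓ q then tab ℓ (idx ℓ q) x else 0)

    -- cumulative frequency in the previous frame before block q
    -- (ghost table where the needed table was already overwritten in this frame)
    cumPrev : ℕ → ℕ
    cumPrev q = sumBelow k (λ ℓ →
      if 1 ≤ᵇ digit ℓ q
      then (if suc (idx ℓ q) * (d ^ ℓ) ≤ᵇ pos then ghost ℓ x else tab ℓ (idx ℓ q) x)
      else 0)

    WinQuery : ℕ → ℕ
    WinQuery zero = 0
    WinQuery (suc v) =
      if suc v ≤ᵇ suc pos
      then prefix ∸ cumCur (suc pos ∸ suc v)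
      else (prefix + tab (k ∸ 1) (d ∸ 1) x) ∸ cumPrev (n + suc pos ∸ suc v)

    BlockIntervalQuery : ℕ → ℕ → ℕ
    BlockIntervalQuery i j = if i ≡ᵇ 0 then WinQuery j else WinQuery j ∸ WinQuery i

module Submission where

-- Number the blocks so that the stream is preceded by one empty frame, and let C a be the
-- number of blocks numbered below a that contain x.  The invariant is that every table of
-- ACC_k (incomplete, stored or ghost) holds C a ∸ C b for the range of blocks it describes,
-- in the current frame or, for tables not yet overwritten and for ghost tables, in the
-- previous one; ADD preserves it because x enters a block at most once.  For block q of a
-- frame a query reads, for each nonzero base-d digit of q, the table of the segment just
-- before q's segment in its parent; these differences telescope to C (frame + q) ∸ C frame,
-- and WinQuery combines two such sums into C now ∸ C (now ∸ w), which is g_x^w.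

open import Data.Bool using (true; false; if_then_else_)
open import Data.Empty using (⊥-elim)
open import Data.List using (List; []; _∷_; length; take; drop; foldl)
open import Data.List.Relation.Unary.All using (All; []; _∷_)
open import Data.List.Relation.Unary.AllPairs using (_∷_)
open import Data.List.Relation.Unary.Unique.Propositional using (Unique)
open import Data.Nat
open import Data.Nat.DivMod hiding (_div_; _mod_)
open import Data.Nat.Divisibility using (n∣m*n)
open import Data.Nat.Properties
open import Data.Product using (Σ; _×_; _,_; proj₂)
open import Data.Sum using (inj₁; inj₂)
open import Function using (_∘′_)
open import Relation.Binary.Definitions using (DecidableEquality)
open import Relation.Binary.PropositionalEquality
open import Relation.Nullary using (¬_; yes; no)
open import Relation.Nullary.Reflects using (Reflects; ofʸ; ofⁿ; fromEquivalence)

open import Defs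

≡ᵇ-reflects-≡ : ∀ m n → Reflects (m ≡ n) (m ≡ᵇ n)
≡ᵇ-reflects-≡ m n = fromEquivalence (≡ᵇ⇒≡ m n) (≡⇒≡ᵇ m n)

[m∸n]+[n∸o]≡m∸o : ∀ {m n o} → o ≤ n → n ≤ m → (m ∸ n) + (n ∸ o) ≡ m ∸ o
[m∸n]+[n∸o]≡m∸o {m} {n} {o} o≤n n≤m = sym (begin
  m ∸ o                         ≡⟨ cong (_∸ o) (sym (m∸n+n≡m n≤m)) ⟩
  (m ∸ n) + n ∸ o               ≡⟨ +-∸-assoc (m ∸ n) o≤n ⟩
  (m ∸ n) + (n ∸ o)             ∎)
  where open ≡-Reasoning

[m∸o]∸[n∸o]≡m∸n : ∀ {m n o} → o ≤ n → n ≤ m → (m ∸ o) ∸ (n ∸ o) ≡ m ∸ n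
[m∸o]∸[n∸o]≡m∸n {m} {n} {o} o≤n n≤m = begin
  (m ∸ o) ∸ (n ∸ o)             ≡⟨ cong (_∸ (n ∸ o)) (sym ([m∸n]+[n∸o]≡m∸o o≤n n≤m)) ⟩
  (m ∸ n) + (n ∸ o) ∸ (n ∸ o)   ≡⟨ m+n∸n≡m (m ∸ n) (n ∸ o) ⟩
  m ∸ n                         ∎
  where open ≡-Reasoning

sumBelow-cong : ∀ K {f h : ℕ → ℕ} → (∀ ℓ → ℓ < K → f ℓ ≡ h ℓ) → sumBelow K f ≡ sumBelow K h
sumBelow-cong zero    f≡h = refl
sumBelow-cong (suc K) f≡h =
  cong₂ _+_ (sumBelow-cong K (λ ℓ ℓ<K → f≡h ℓ (m<n⇒m<1+n ℓ<K))) (f≡h K ≤-refl)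

sumBelow-telescope : ∀ (h : ℕ → ℕ) → (∀ ℓ → h (suc ℓ) ≤ h ℓ) → ∀ K →
                     sumBelow K (λ ℓ → h ℓ ∸ h (suc ℓ)) ≡ h 0 ∸ h K
sumBelow-telescope h antitone zero    = sym (n∸n≡0 (h 0))
sumBelow-telescope h antitone (suc K) =
  trans (cong (_+ (h K ∸ h (suc K))) (sumBelow-telescope h antitone K))
        ([m∸n]+[n∸o]≡m∸o (antitone K) (h≤h0 K))
  where
  h≤h0 : ∀ K → h K ≤ h 0
  h≤h0 zero    = ≤-refl
  h≤h0 (suc K) = ≤-trans (antitone K) (h≤h0 K)

module _ (n : ℕ) .{{_ : NonZero n}} where

  [m+kn]/n≡k : ∀ m k → m < n → (m + k * n) / n ≡ k
  [m+kn]/n≡k m k m<n = begin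
    (m + k * n) / n    ≡⟨ +-distrib-/-∣ʳ m (n∣m*n k) ⟩
    m / n + k * n / n  ≡⟨ cong₂ _+_ (m<n⇒m/n≡0 m<n) (m*n/n≡m k n) ⟩
    k                  ∎
    where open ≡-Reasoning

  m%n≡0⇒m/n*n≡m : ∀ m → m % n ≡ 0 → m / n * n ≡ m
  m%n≡0⇒m/n*n≡m m m%n≡0 = sym (trans (m≡m%n+[m/n]*n m n) (cong (_+ m / n * n) m%n≡0))

  [1+m]/n≡1+m/n : ∀ m → suc m % n ≡ 0 → suc m / n ≡ suc (m / n)
  [1+m]/n≡1+m/n m [1+m]%n≡0 = trans (cong (_/ n) suc-m≡) (m*n/n≡m (suc (m / n)) n)
    where
    suc-m≡ : suc m ≡ suc (m / n) * n
    suc-m≡ = begin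
      suc m                    ≡⟨ cong suc (m≡m%n+[m/n]*n m n) ⟩
      suc (m % n) + m / n * n  ≡⟨ cong (λ r → suc r + m / n * n) (%-pred-≡0 [1+m]%n≡0) ⟩
      suc (n ∸ 1) + m / n * n  ≡⟨ cong (_+ m / n * n) (suc-pred n) ⟩
      n + m / n * n            ∎
      where open ≡-Reasoning

  [1+m]/n≡m/n : ∀ m → suc m % n ≢ 0 → suc m / n ≡ m / n
  [1+m]/n≡m/n m [1+m]%n≢0 with m≤n⇒m<n∨m≡n (m%n<n m n)
  ... | inj₁ 1+m%n<n = trans (cong (_/ n) (cong suc (m≡m%n+[m/n]*n m n)))
                             ([m+kn]/n≡k (suc (m % n)) (m / n) 1+m%n<n)
  ... | inj₂ 1+m%n≡n = ⊥-elim ([1+m]%n≢0 (trans (cong (_% n) suc-m≡) (m*n%n≡0 (suc (m / n)) n)))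
    where
    suc-m≡ : suc m ≡ suc (m / n) * n
    suc-m≡ = trans (cong suc (m≡m%n+[m/n]*n m n)) (cong (_+ m / n * n) 1+m%n≡n)

  m%n≢0⇒[m∸1]/n≡m/n : ∀ m → m % n ≢ 0 → (m ∸ 1) / n ≡ m / n
  m%n≢0⇒[m∸1]/n≡m/n zero    0%n≢0 = ⊥-elim (0%n≢0 (m*n%n≡0 0 n))
  m%n≢0⇒[m∸1]/n≡m/n (suc m) m%n≢0 = sym ([1+m]/n≡m/n m m%n≢0)

module _ (d P : ℕ) .{{_ : NonZero d}} .{{_ : NonZero P}} where
  private instance
    d*P≢0 : NonZero (d * P)
    d*P≢0 = m*n≢0 d P
    P*d≢0 : NonZero (P * d)
    P*d≢0 = m*n≢0 P d

  m/P/d≡m/[d*P] : ∀ m → m / P / d ≡ m / (d * P)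
  m/P/d≡m/[d*P] m = trans (m/n/o≡m/[n*o] m P d) (/-congʳ (*-comm P d))

  private
    m/[d*P]*[d*P]≡m/P/d*d*P : ∀ m → m / (d * P) * (d * P) ≡ m / P / d * d * P
    m/[d*P]*[d*P]≡m/P/d*d*P m = trans (cong (_* (d * P)) (sym (m/P/d≡m/[d*P] m))) (sym (*-assoc (m / P / d) d P))

  m/[d*P]*[d*P]≤m/P*P : ∀ m → m / (d * P) * (d * P) ≤ m / P * P
  m/[d*P]*[d*P]≤m/P*P m = subst (_≤ m / P * P) (sym (m/[d*P]*[d*P]≡m/P/d*d*P m)) (*-monoˡ-≤ P (m/n*n≤m (m / P) d))

  m/P%d≡0⇒m/[d*P]*[d*P]≡m/P*P : ∀ m → m / P % d ≡ 0 → m / (d * P) * (d * P) ≡ m / P * P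
  m/P%d≡0⇒m/[d*P]*[d*P]≡m/P*P m m/P%d≡0 =
    trans (m/[d*P]*[d*P]≡m/P/d*d*P m) (cong (_* P) (m%n≡0⇒m/n*n≡m d (m / P) m/P%d≡0))

  m/P%d>0⇒[m/P∸1]/d*[d*P]≡m/[d*P]*[d*P] : ∀ m → 0 < m / P % d →
                                           (m / P ∸ 1) / d * (d * P) ≡ m / (d * P) * (d * P)
  m/P%d>0⇒[m/P∸1]/d*[d*P]≡m/[d*P]*[d*P] m 0<m/P%d = cong (_* (d * P)) (begin
    (m / P ∸ 1) / d  ≡⟨ m%n≢0⇒[m∸1]/n≡m/n d (m / P) (m<n⇒n≢0 0<m/P%d) ⟩
    m / P / d        ≡⟨ m/P/d≡m/[d*P] m ⟩
    m / (d * P)      ∎)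
    where open ≡-Reasoning

blockStep-unique⁻ : ∀ {U : Set} (B : List (List U)) op → All Unique (blockStep B op) → All Unique B
blockStep-unique⁻ []      _        _                = []
blockStep-unique⁻ (b ∷ B) (add y)  ((_ ∷ ub) ∷ uB) = ub ∷ uB
blockStep-unique⁻ (b ∷ B) endblock (_ ∷ uB)        = uB

foldl-blockStep-unique⁻ : ∀ {U : Set} ops (B : List (List U)) →
                          All Unique (foldl blockStep B ops) → All Unique B
foldl-blockStep-unique⁻ []         B u = u
foldl-blockStep-unique⁻ (op ∷ ops) B u =
  blockStep-unique⁻ B op (foldl-blockStep-unique⁻ ops (blockStep B op) u)

module _ {U : Set} (_≟_ : DecidableEquality U) (x : U) where

  mem-∷-≢ : ∀ {y} b → x ≢ y → mem _≟_ x (y ∷ b) ≡ mem _≟_ x b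
  mem-∷-≢ {y} b x≢y with x ≟ y
  ... | yes x≡y = ⊥-elim (x≢y x≡y)
  ... | no  _   = refl

  mem-∷-≡ : ∀ b → mem _≟_ x (x ∷ b) ≡ true
  mem-∷-≡ b with x ≟ x
  ... | yes _   = refl
  ... | no  x≢x = ⊥-elim (x≢x refl)

  All≢⇒mem≡false : ∀ {b} → All (x ≢_) b → mem _≟_ x b ≡ false
  All≢⇒mem≡false {[]}    []          = refl
  All≢⇒mem≡false {y ∷ b} (x≢y ∷ x∉b) = trans (mem-∷-≢ b x≢y) (All≢⇒mem≡false x∉b)

  countBlocks-take+drop : ∀ w L →
                          countBlocks _≟_ x (take w L) + countBlocks _≟_ x (drop w L) ≡ countBlocks _≟_ x L
  countBlocks-take+drop zero    L       = refl
  countBlocks-take+drop (suc w) []      = refl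
  countBlocks-take+drop (suc w) (b ∷ L) =
    trans (+-assoc (if mem _≟_ x b then 1 else 0) _ _) (cong (_ +_) (countBlocks-take+drop w L))

  countBlocks-drop-≤ : ∀ m L → countBlocks _≟_ x (drop m L) ≤ countBlocks _≟_ x L
  countBlocks-drop-≤ zero    L       = ≤-refl
  countBlocks-drop-≤ (suc m) []      = z≤n
  countBlocks-drop-≤ (suc m) (b ∷ L) = ≤-trans (countBlocks-drop-≤ m L) (m≤n+m _ _)

  countBlocks-drop-antitone : ∀ {m m'} L → m ≤ m' →
                              countBlocks _≟_ x (drop m' L) ≤ countBlocks _≟_ x (drop m L)
  countBlocks-drop-antitone {m' = m'} L       z≤n        = countBlocks-drop-≤ m' L
  countBlocks-drop-antitone           []      (s≤s m≤m') = z≤n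
  countBlocks-drop-antitone           (b ∷ L) (s≤s m≤m') = countBlocks-drop-antitone L m≤m'

module Correctness {U : Set} (_≟_ : DecidableEquality U) (d-1 k : ℕ) (x : U) where

  d : ℕ
  d = suc d-1

  open ACC _≟_ d k
  open State using (pos; inc; tab; ghost)

  nz : ∀ ℓ → NonZero (d ^ ℓ)
  nz ℓ = m^n≢0 d ℓ

  segIndex : ℕ → ℕ → ℕ
  segIndex ℓ q = _/_ q (d ^ ℓ) {{nz ℓ}}

  segStart : ℕ → ℕ → ℕ
  segStart ℓ q = segIndex ℓ q * d ^ ℓ

  EndsAt : ℕ → ℕ → Set
  EndsAt ℓ p = _%_ (suc p) (d ^ ℓ) {{nz ℓ}} ≡ 0

  idx≡ : ∀ ℓ q → idx ℓ q ≡ segIndex ℓ q ∸ 1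
  idx≡ ℓ q with d ^ ℓ | nz ℓ
  ... | suc _ | _ = refl

  digit≡ : ∀ ℓ q → digit ℓ q ≡ segIndex ℓ q % d
  digit≡ ℓ q with d ^ ℓ | nz ℓ
  ... | suc _ | _ = refl

  mod-d^≡ : ∀ ℓ m → m mod (d ^ ℓ) ≡ _%_ m (d ^ ℓ) {{nz ℓ}}
  mod-d^≡ ℓ m with d ^ ℓ | nz ℓ
  ... | suc _ | _ = refl

  ends-reflects : ∀ ℓ p → Reflects (EndsAt ℓ p) (ends ℓ p)
  ends-reflects ℓ p rewrite mod-d^≡ ℓ (suc p) = ≡ᵇ-reflects-≡ _ 0

  0<segment-end : ∀ ℓ t → 0 < suc t * d ^ ℓ
  0<segment-end ℓ t = <-≤-trans (m^n>0 d ℓ) (m≤m+n (d ^ ℓ) (t * d ^ ℓ))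

  segStart-≤ : ∀ ℓ q → segStart ℓ q ≤ q
  segStart-≤ ℓ q = m/n*n≤m q (d ^ ℓ) {{nz ℓ}}

  segStart-zero : ∀ q → segStart 0 q ≡ q
  segStart-zero q = trans (cong (_* 1) (n/1≡n q)) (*-identityʳ q)

  segStart-suc-≤ : ∀ ℓ q → segStart (suc ℓ) q ≤ segStart ℓ q
  segStart-suc-≤ ℓ q = m/[d*P]*[d*P]≤m/P*P d (d ^ ℓ) {{_}} {{nz ℓ}} q

  segStart-top : ∀ q → q < n → segStart k q ≡ 0
  segStart-top q q<n = cong (_* n) (m<n⇒m/n≡0 {{nz k}} q<n)

  segStart-suc-≡ : ∀ ℓ q → segIndex ℓ q % d ≡ 0 → segStart (suc ℓ) q ≡ segStart ℓ q
  segStart-suc-≡ ℓ q = m/P%d≡0⇒m/[d*P]*[d*P]≡m/P*P d (d ^ ℓ) {{_}} {{nz ℓ}} q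

  0<segIndex : ∀ ℓ q → 0 < segIndex ℓ q % d → 0 < segIndex ℓ q
  0<segIndex ℓ q 0<digit = <-≤-trans 0<digit (m%n≤m (segIndex ℓ q) d)

  preceding-end : ∀ ℓ q → 0 < segIndex ℓ q → suc (segIndex ℓ q ∸ 1) * d ^ ℓ ≡ segStart ℓ q
  preceding-end ℓ q 0<index = cong (_* d ^ ℓ) (suc-pred (segIndex ℓ q) {{>-nonZero 0<index}})

  preceding-parent : ∀ ℓ q → 0 < segIndex ℓ q % d →
                     (segIndex ℓ q ∸ 1) / d * d ^ suc ℓ ≡ segStart (suc ℓ) q
  preceding-parent ℓ q = m/P%d>0⇒[m/P∸1]/d*[d*P]≡m/[d*P]*[d*P] d (d ^ ℓ) {{_}} {{nz ℓ}} q

  segIndex-suc-≢ : ∀ ℓ p → ¬ EndsAt ℓ p → segIndex ℓ (suc p) ≡ segIndex ℓ p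
  segIndex-suc-≢ ℓ = [1+m]/n≡m/n (d ^ ℓ) {{nz ℓ}}

  segIndex-suc-≡ : ∀ ℓ p → EndsAt ℓ p → segIndex ℓ (suc p) ≡ suc (segIndex ℓ p)
  segIndex-suc-≡ ℓ = [1+m]/n≡1+m/n (d ^ ℓ) {{nz ℓ}}

  ended-end : ∀ ℓ p → EndsAt ℓ p → suc (segIndex ℓ (suc p) ∸ 1) * d ^ ℓ ≡ suc p
  ended-end ℓ p ends = begin
    suc (segIndex ℓ (suc p) ∸ 1) * d ^ ℓ  ≡⟨ cong (λ i → suc (i ∸ 1) * d ^ ℓ) (segIndex-suc-≡ ℓ p ends) ⟩
    suc (segIndex ℓ p) * d ^ ℓ            ≡⟨ cong (_* d ^ ℓ) (segIndex-suc-≡ ℓ p ends) ⟨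
    segIndex ℓ (suc p) * d ^ ℓ            ≡⟨ m%n≡0⇒m/n*n≡m (d ^ ℓ) {{nz ℓ}} (suc p) ends ⟩
    suc p                                 ∎
    where open ≡-Reasoning

  ended-parent : ∀ ℓ p → EndsAt ℓ p → (segIndex ℓ (suc p) ∸ 1) / d * d ^ suc ℓ ≡ segStart (suc ℓ) p
  ended-parent ℓ p ends = cong (_* d ^ suc ℓ) (begin
    (segIndex ℓ (suc p) ∸ 1) / d  ≡⟨ cong (λ i → (i ∸ 1) / d) (segIndex-suc-≡ ℓ p ends) ⟩
    segIndex ℓ p / d              ≡⟨ m/P/d≡m/[d*P] d (d ^ ℓ) {{_}} {{nz ℓ}} p ⟩
    segIndex (suc ℓ) p            ∎)
    where open ≡-Reasoning

  ended-segment : ∀ ℓ p t → suc t * d ^ ℓ ≡ suc p → EndsAt ℓ p × segIndex ℓ (suc p) ∸ 1 ≡ t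
  ended-segment ℓ p t end≡ =
    subst (λ m → _%_ m (d ^ ℓ) {{nz ℓ}} ≡ 0) end≡ (m*n%n≡0 (suc t) (d ^ ℓ) {{nz ℓ}}) ,
    cong (_∸ 1) (subst (λ m → _/_ m (d ^ ℓ) {{nz ℓ}} ≡ suc t) end≡ (m*n/n≡m (suc t) (d ^ ℓ) {{nz ℓ}}))

  count : List (List U) → ℕ
  count = countBlocks _≟_ x

  -- Blocks are numbered oldest first starting from n; the numbers below n stand for an
  -- empty frame preceding the stream, so that every frame has a previous one.
  countBelow : List (List U) → ℕ → ℕ
  countBelow B a = count (drop (length B + n ∸ a) B)

  countBelow-mono : ∀ B {a b} → a ≤ b → countBelow B a ≤ countBelow B b
  countBelow-mono B a≤b = countBlocks-drop-antitone _≟_ x B (∸-monoʳ-≤ (length B + n) a≤b)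

  countBelow-all : ∀ B a → length B + n ≤ a → countBelow B a ≡ count B
  countBelow-all B a all≤a = cong (λ m → count (drop m B)) (m≤n⇒m∸n≡0 all≤a)

  countBelow-initial : ∀ a → countBelow ([] ∷ []) a ≡ 0
  countBelow-initial a with 1 + n ∸ a
  ... | zero        = refl
  ... | suc zero    = refl
  ... | suc (suc m) = refl

  countBelow-endblock : ∀ B a → countBelow ([] ∷ B) a ≡ countBelow B a
  countBelow-endblock B a with a ≤? length B + n
  ... | yes a≤ = cong (λ m → count (drop m ([] ∷ B))) (+-∸-assoc 1 a≤)
  ... | no  a≰ = trans (countBelow-all ([] ∷ B) a (≰⇒> a≰)) (sym (countBelow-all B a (<⇒≤ (≰⇒> a≰))))

  countBelow-endblock-∸ : ∀ B a b →
                          countBelow ([] ∷ B) a ∸ countBelow ([] ∷ B) b ≡ countBelow B a ∸ countBelow B b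
  countBelow-endblock-∸ B a b = cong₂ _∸_ (countBelow-endblock B a) (countBelow-endblock B b)

  countBelow-add-old : ∀ y b B a → a < length (b ∷ B) + n → countBelow ((y ∷ b) ∷ B) a ≡ countBelow (b ∷ B) a
  countBelow-add-old y b B a a< with length (b ∷ B) + n ∸ a | m>n⇒m∸n≢0 a<
  ... | zero  | ≢0 = ⊥-elim (≢0 refl)
  ... | suc m | _  = refl

  countBelow-add-≢ : ∀ {y} b B → x ≢ y → ∀ a → countBelow ((y ∷ b) ∷ B) a ≡ countBelow (b ∷ B) a
  countBelow-add-≢ b B x≢y a with length (b ∷ B) + n ∸ a
  ... | zero  = cong (λ m → (if m then 1 else 0) + count B) (mem-∷-≢ _≟_ x b x≢y)
  ... | suc m = refl

  countBelow-add-new : ∀ b B a → mem _≟_ x b ≡ false → length (b ∷ B) + n ≤ a →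
                       countBelow ((x ∷ b) ∷ B) a ≡ suc (countBelow (b ∷ B) a)
  countBelow-add-new b B a x∉b all≤a = begin
    countBelow ((x ∷ b) ∷ B) a  ≡⟨ countBelow-all ((x ∷ b) ∷ B) a all≤a ⟩
    count ((x ∷ b) ∷ B)         ≡⟨ cong (λ m → (if m then 1 else 0) + count B) (mem-∷-≡ _≟_ x b) ⟩
    suc (count B)               ≡⟨ cong (λ m → suc ((if m then 1 else 0) + count B)) (sym x∉b) ⟩
    suc (count (b ∷ B))         ≡⟨ cong suc (sym (countBelow-all (b ∷ B) a all≤a)) ⟩
    suc (countBelow (b ∷ B) a)  ∎
    where open ≡-Reasoning

  -- Segment t of level ℓ ends at block (t+1)d^ℓ of its frame, and its parent starts at ⌊t/d⌋d^(ℓ+1).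
  table : List (List U) → ℕ → ℕ → ℕ → ℕ
  table B f ℓ t = countBelow B (f + suc t * d ^ ℓ) ∸ countBelow B (f + t / d * d ^ suc ℓ)

  parent-start-≤ : ∀ ℓ t → t / d * d ^ suc ℓ ≤ suc t * d ^ ℓ
  parent-start-≤ ℓ t = begin
    t / d * d ^ suc ℓ    ≡⟨ *-assoc (t / d) d (d ^ ℓ) ⟨
    t / d * d * d ^ ℓ    ≤⟨ *-monoˡ-≤ (d ^ ℓ) (m/n*n≤m t d) ⟩
    t * d ^ ℓ            ≤⟨ *-monoˡ-≤ (d ^ ℓ) (n≤1+n t) ⟩
    suc t * d ^ ℓ        ∎
    where open ≤-Reasoning

  table-endblock : ∀ B f ℓ t → table ([] ∷ B) f ℓ t ≡ table B f ℓ t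
  table-endblock B f ℓ t = countBelow-endblock-∸ B (f + suc t * d ^ ℓ) (f + t / d * d ^ suc ℓ)

  table-add-old : ∀ y b B f ℓ t → f + suc t * d ^ ℓ < length (b ∷ B) + n →
                  table ((y ∷ b) ∷ B) f ℓ t ≡ table (b ∷ B) f ℓ t
  table-add-old y b B f ℓ t end< = cong₂ _∸_
    (countBelow-add-old y b B _ end<)
    (countBelow-add-old y b B _ (≤-<-trans (+-monoʳ-≤ f (parent-start-≤ ℓ t)) end<))

  table-preceding : ∀ B f ℓ q → 0 < segIndex ℓ q % d →
                    table B f ℓ (segIndex ℓ q ∸ 1) ≡
                    countBelow B (f + segStart ℓ q) ∸ countBelow B (f + segStart (suc ℓ) q)
  table-preceding B f ℓ q 0<digit = cong₂ (λ a b → countBelow B (f + a) ∸ countBelow B (f + b))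
    (preceding-end ℓ q (0<segIndex ℓ q 0<digit)) (preceding-parent ℓ q 0<digit)

  -- f numbers the first block of the previous frame; the current frame starts at f + n.
  record Invariant (B : List (List U)) (f : ℕ) (s : State U) : Set where
    field
      length≡      : length B ≡ f + suc (pos s)
      pos<n        : pos s < n
      inc≡         : ∀ ℓ → ℓ < k →
                     inc s ℓ x ≡ countBelow B (f + n + suc (pos s)) ∸ countBelow B (f + n + segStart (suc ℓ) (pos s))
      tab-current  : ∀ ℓ t → ℓ < k → suc t * d ^ ℓ ≤ pos s → tab s ℓ t x ≡ table B (f + n) ℓ t
      tab-previous : ∀ ℓ t → ℓ < k → pos s < suc t * d ^ ℓ → suc t * d ^ ℓ ≤ n →
                     tab s ℓ t x ≡ table B f ℓ t
      ghost≡       : ∀ ℓ → ℓ < k → d ^ ℓ ≤ pos s → ghost s ℓ x ≡ table B f ℓ (segIndex ℓ (pos s) ∸ 1)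

    now≡ : length B + n ≡ f + n + suc (pos s)
    now≡ = begin
      length B + n          ≡⟨ cong (_+ n) length≡ ⟩
      f + suc (pos s) + n   ≡⟨ +-assoc f (suc (pos s)) n ⟩
      f + (suc (pos s) + n) ≡⟨ cong (f +_) (+-comm (suc (pos s)) n) ⟩
      f + (n + suc (pos s)) ≡⟨ +-assoc f n (suc (pos s)) ⟨
      f + n + suc (pos s)   ∎
      where open ≡-Reasoning

    countBelow-from-now : ∀ a → f + n + suc (pos s) ≤ a → countBelow B a ≡ count B
    countBelow-from-now a now≤a = countBelow-all B a (≤-trans (≤-reflexive now≡) now≤a)

  no-invariant-for-[] : ∀ {f s} → ¬ Invariant [] f s
  no-invariant-for-[] {f} {s} I = 0≢1+n (trans (Invariant.length≡ I) (+-suc f (pos s)))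

  initial : Invariant ([] ∷ []) 0 init
  initial = record
    { length≡      = refl
    ; pos<n        = m^n>0 d k
    ; inc≡         = λ ℓ _ → empty-difference (n + 1) (n + segStart (suc ℓ) 0)
    ; tab-current  = λ ℓ t _ end≤0 → ⊥-elim (<⇒≱ (0<segment-end ℓ t) end≤0)
    ; tab-previous = λ ℓ t _ _ _ → empty-difference (suc t * d ^ ℓ) (t / d * d ^ suc ℓ)
    ; ghost≡       = λ ℓ _ d^ℓ≤0 → ⊥-elim (<⇒≱ (m^n>0 d ℓ) d^ℓ≤0)
    }
    where
    empty-difference : ∀ a b → 0 ≡ countBelow ([] ∷ []) a ∸ countBelow ([] ∷ []) b
    empty-difference a b = sym (cong₂ _∸_ (countBelow-initial a) (countBelow-initial b))

  add-preserves : ∀ y b B f s → Invariant (b ∷ B) f s → (y ≡ x → mem _≟_ x b ≡ false) →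
                  Invariant ((y ∷ b) ∷ B) f (ADD s y)
  add-preserves y b B f s I x-new = record
    { length≡      = length≡
    ; pos<n        = pos<n
    ; inc≡         = inc≡′
    ; tab-current  = λ ℓ t ℓ<k end≤p → trans (tab-current ℓ t ℓ<k end≤p)
                       (sym (table-add-old y b B (f + n) ℓ t (current< end≤p)))
    ; tab-previous = λ ℓ t ℓ<k p<end end≤n → trans (tab-previous ℓ t ℓ<k p<end end≤n)
                       (sym (table-add-old y b B f ℓ t (previous< end≤n)))
    ; ghost≡       = λ ℓ ℓ<k d^ℓ≤p → trans (ghost≡ ℓ ℓ<k d^ℓ≤p)
                       (sym (table-add-old y b B f ℓ (segIndex ℓ p ∸ 1) (previous< (ghost-in-frame ℓ d^ℓ≤p))))
    }
    where
    open Invariant I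
    p = pos s

    current< : ∀ {m} → m ≤ p → f + n + m < length (b ∷ B) + n
    current< {m} m≤p = subst (f + n + m <_) (sym now≡) (+-monoʳ-< (f + n) (s≤s m≤p))

    previous< : ∀ {m} → m ≤ n → f + m < length (b ∷ B) + n
    previous< {m} m≤n = subst (f + m <_) (sym now≡) (≤-<-trans (+-monoʳ-≤ f m≤n) (m<m+n (f + n) z<s))

    ghost-in-frame : ∀ ℓ → d ^ ℓ ≤ p → suc (segIndex ℓ p ∸ 1) * d ^ ℓ ≤ n
    ghost-in-frame ℓ d^ℓ≤p = subst (_≤ n) (sym (preceding-end ℓ p (m≥n⇒m/n>0 {{nz ℓ}} d^ℓ≤p)))
                                   (≤-trans (segStart-≤ ℓ p) (<⇒≤ pos<n))

    inc≡′ : ∀ ℓ → ℓ < k → inc (ADD s y) ℓ x ≡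
            countBelow ((y ∷ b) ∷ B) (f + n + suc p) ∸ countBelow ((y ∷ b) ∷ B) (f + n + segStart (suc ℓ) p)
    inc≡′ ℓ ℓ<k with ℓ <ᵇ k | <ᵇ-reflects-< ℓ k
    ... | false | ofⁿ ℓ≮k = ⊥-elim (ℓ≮k ℓ<k)
    ... | true  | _ with x ≟ y
    ... | no x≢y = trans (inc≡ ℓ ℓ<k) (sym (cong₂ _∸_
                     (countBelow-add-≢ b B x≢y (f + n + suc p))
                     (countBelow-add-≢ b B x≢y (f + n + segStart (suc ℓ) p))))
    ... | yes refl = begin
      suc (inc s ℓ x)
        ≡⟨ cong suc (inc≡ ℓ ℓ<k) ⟩
      suc (countBelow (b ∷ B) now ∸ countBelow (b ∷ B) start)
        ≡⟨ +-∸-assoc 1 (countBelow-mono (b ∷ B) start≤now) ⟨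
      suc (countBelow (b ∷ B) now) ∸ countBelow (b ∷ B) start
        ≡⟨ cong₂ _∸_ (countBelow-add-new b B now (x-new refl) (≤-reflexive now≡))
                     (countBelow-add-old x b B start (current< (segStart-≤ (suc ℓ) p))) ⟨
      countBelow ((x ∷ b) ∷ B) now ∸ countBelow ((x ∷ b) ∷ B) start ∎
      where
      open ≡-Reasoning
      now = f + n + suc p
      start = f + n + segStart (suc ℓ) p
      start≤now : start ≤ now
      start≤now = +-monoʳ-≤ (f + n) (≤-trans (segStart-≤ (suc ℓ) p) (n≤1+n p))

  -- Proving an invariant for record s { pos = q } keeps every field stated in terms of q.
  with-pos : ∀ (s : State U) {q} → pos s ≡ q → record s { pos = q } ≡ s
  with-pos s refl = refl

  module EndBlock {B f s} (I : Invariant B f s) where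
    open Invariant I
    p = pos s

    inc-completes : ∀ ℓ → ℓ < k → EndsAt ℓ p → inc s ℓ x ≡ table B (f + n) ℓ (segIndex ℓ (suc p) ∸ 1)
    inc-completes ℓ ℓ<k ends = trans (inc≡ ℓ ℓ<k)
      (cong₂ (λ a b → countBelow B (f + n + a) ∸ countBelow B (f + n + b))
             (sym (ended-end ℓ p ends)) (sym (ended-parent ℓ p ends)))

    tab-completed : ∀ ℓ t → ℓ < k → suc t * d ^ ℓ ≡ suc p → tab (ENDBLOCK s) ℓ t x ≡ table B (f + n) ℓ t
    tab-completed ℓ t ℓ<k end≡ with ended-segment ℓ p t end≡
    ... | ended , index≡t
      with ℓ <ᵇ k | <ᵇ-reflects-< ℓ k | ends ℓ p | ends-reflects ℓ p
         | t ≡ᵇ idx ℓ (suc p) | ≡ᵇ-reflects-≡ t (idx ℓ (suc p))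
    ... | false | ofⁿ ℓ≮k | _     | _         | _     | _ = ⊥-elim (ℓ≮k ℓ<k)
    ... | true  | _       | false | ofⁿ ¬ends | _     | _ = ⊥-elim (¬ends ended)
    ... | true  | _       | true  | _         | false | ofⁿ t≢idx =
      ⊥-elim (t≢idx (trans (sym index≡t) (sym (idx≡ ℓ (suc p)))))
    ... | true  | _       | true  | _         | true  | _ =
      subst (λ i → inc s ℓ x ≡ table B (f + n) ℓ i) index≡t (inc-completes ℓ ℓ<k ended)

    tab-untouched : ∀ ℓ t → suc t * d ^ ℓ ≢ suc p → tab (ENDBLOCK s) ℓ t x ≡ tab s ℓ t x
    tab-untouched ℓ t end≢
      with ℓ <ᵇ k | ends ℓ p | ends-reflects ℓ p | t ≡ᵇ idx ℓ (suc p) | ≡ᵇ-reflects-≡ t (idx ℓ (suc p))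
    ... | true  | true  | ofʸ ends | true  | ofʸ t≡idx =
      ⊥-elim (end≢ (trans (cong (λ i → suc i * d ^ ℓ) (trans t≡idx (idx≡ ℓ (suc p)))) (ended-end ℓ p ends)))
    ... | true  | true  | _ | false | _ = refl
    ... | true  | false | _ | _     | _ = refl
    ... | false | _     | _ | _     | _ = refl

    tab-updated : ∀ ℓ t → ℓ < k → suc t * d ^ ℓ ≤ suc p → tab (ENDBLOCK s) ℓ t x ≡ table B (f + n) ℓ t
    tab-updated ℓ t ℓ<k end≤ with m≤n⇒m<n∨m≡n end≤
    ... | inj₁ end<p+1 = trans (tab-untouched ℓ t (<⇒≢ end<p+1)) (tab-current ℓ t ℓ<k (≤-pred end<p+1))
    ... | inj₂ end≡p+1 = tab-completed ℓ t ℓ<k end≡p+1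

    no-wrap : suc p < n → Invariant ([] ∷ B) f (ENDBLOCK s)
    no-wrap p+1<n = subst (Invariant ([] ∷ B) f) (with-pos (ENDBLOCK s) pos≡) (record
      { length≡      = trans (cong suc length≡) (sym (+-suc f (suc p)))
      ; pos<n        = p+1<n
      ; inc≡         = λ ℓ ℓ<k → trans (inc≡′ ℓ ℓ<k)
                         (sym (countBelow-endblock-∸ B (f + n + suc (suc p)) (f + n + segStart (suc ℓ) (suc p))))
      ; tab-current  = λ ℓ t ℓ<k end≤ → trans (tab-updated ℓ t ℓ<k end≤) (sym (table-endblock B (f + n) ℓ t))
      ; tab-previous = λ ℓ t ℓ<k p+1<end end≤n → trans (tab-untouched ℓ t (>⇒≢ p+1<end))
                         (trans (tab-previous ℓ t ℓ<k (<-trans (n<1+n p) p+1<end) end≤n)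
                                (sym (table-endblock B f ℓ t)))
      ; ghost≡       = λ ℓ ℓ<k d^ℓ≤p+1 → trans (ghost′ ℓ ℓ<k d^ℓ≤p+1)
                         (sym (table-endblock B f ℓ (segIndex ℓ (suc p) ∸ 1)))
      })
      where
      pos≡ : pos (ENDBLOCK s) ≡ suc p
      pos≡ = trans (mod-d^≡ k (suc p)) (m<n⇒m%n≡m {{nz k}} p+1<n)

      inc≡′ : ∀ ℓ → ℓ < k → inc (ENDBLOCK s) ℓ x ≡
              countBelow B (f + n + suc (suc p)) ∸ countBelow B (f + n + segStart (suc ℓ) (suc p))
      inc≡′ ℓ ℓ<k with ends (suc ℓ) p | ends-reflects (suc ℓ) p
      ... | true  | ofʸ ends = sym (begin
        countBelow B (f + n + suc (suc p)) ∸ countBelow B (f + n + segStart (suc ℓ) (suc p))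
          ≡⟨ cong (λ a → countBelow B (f + n + suc (suc p)) ∸ countBelow B (f + n + a))
                  (m%n≡0⇒m/n*n≡m (d ^ suc ℓ) {{nz (suc ℓ)}} (suc p) ends) ⟩
        countBelow B (f + n + suc (suc p)) ∸ countBelow B (f + n + suc p)
          ≡⟨ cong₂ _∸_ (countBelow-from-now _ (+-monoʳ-≤ (f + n) (n≤1+n (suc p))))
                       (countBelow-from-now _ ≤-refl) ⟩
        count B ∸ count B
          ≡⟨ n∸n≡0 (count B) ⟩
        0 ∎)
        where open ≡-Reasoning
      ... | false | ofⁿ ¬ends = trans (inc≡ ℓ ℓ<k) (cong₂ (λ a b → a ∸ countBelow B (f + n + b))
        (trans (countBelow-from-now _ ≤-refl) (sym (countBelow-from-now _ (+-monoʳ-≤ (f + n) (n≤1+n (suc p))))))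
        (cong (_* d ^ suc ℓ) (sym (segIndex-suc-≢ (suc ℓ) p ¬ends))))

      ghost′ : ∀ ℓ → ℓ < k → d ^ ℓ ≤ suc p →
               ghost (ENDBLOCK s) ℓ x ≡ table B f ℓ (segIndex ℓ (suc p) ∸ 1)
      ghost′ ℓ ℓ<k d^ℓ≤p+1 with ℓ <ᵇ k | <ᵇ-reflects-< ℓ k
      ... | false | ofⁿ ℓ≮k = ⊥-elim (ℓ≮k ℓ<k)
      ... | true  | _ with ends ℓ p | ends-reflects ℓ p
      ... | true  | ofʸ ends = trans (cong (λ i → tab s ℓ i x) (idx≡ ℓ (suc p)))
        (tab-previous ℓ _ ℓ<k (≤-reflexive (sym (ended-end ℓ p ends)))
                              (≤-trans (≤-reflexive (ended-end ℓ p ends)) (<⇒≤ p+1<n)))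
      ... | false | ofⁿ ¬ends = trans (ghost≡ ℓ ℓ<k d^ℓ≤p)
        (cong (λ i → table B f ℓ (i ∸ 1)) (sym (segIndex-suc-≢ ℓ p ¬ends)))
        where
        d^ℓ≢p+1 : d ^ ℓ ≢ suc p
        d^ℓ≢p+1 d^ℓ≡p+1 = ¬ends (subst (λ m → _%_ m (d ^ ℓ) {{nz ℓ}} ≡ 0) d^ℓ≡p+1 (n%n≡0 (d ^ ℓ) {{nz ℓ}}))
        d^ℓ≤p : d ^ ℓ ≤ p
        d^ℓ≤p = ≤-pred (≤∧≢⇒< d^ℓ≤p+1 d^ℓ≢p+1)

    wrap : suc p ≡ n → Invariant ([] ∷ B) (f + n) (ENDBLOCK s)
    wrap p+1≡n = subst (Invariant ([] ∷ B) (f + n)) (with-pos (ENDBLOCK s) pos≡) (record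
      { length≡      = trans (cong suc (trans length≡ (cong (f +_) p+1≡n))) (+-comm 1 (f + n))
      ; pos<n        = m^n>0 d k
      ; inc≡         = inc≡′
      ; tab-current  = λ ℓ t _ end≤0 → ⊥-elim (<⇒≱ (0<segment-end ℓ t) end≤0)
      ; tab-previous = λ ℓ t ℓ<k _ end≤n →
                         trans (tab-updated ℓ t ℓ<k (subst (suc t * d ^ ℓ ≤_) (sym p+1≡n) end≤n))
                         (sym (table-endblock B (f + n) ℓ t))
      ; ghost≡       = λ ℓ _ d^ℓ≤0 → ⊥-elim (<⇒≱ (m^n>0 d ℓ) d^ℓ≤0)
      })
      where
      pos≡ : pos (ENDBLOCK s) ≡ 0
      pos≡ = trans (mod-d^≡ k (suc p)) (trans (%-congˡ {{nz k}} p+1≡n) (n%n≡0 n {{nz k}}))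

      ends-every-level : ∀ ℓ → ℓ ≤ k → EndsAt ℓ p
      ends-every-level ℓ ℓ≤k = trans (%-congˡ {{nz ℓ}} (trans p+1≡n n≡)) (m*n%n≡0 (d ^ (k ∸ ℓ)) (d ^ ℓ) {{nz ℓ}})
        where
        n≡ : n ≡ d ^ (k ∸ ℓ) * d ^ ℓ
        n≡ = trans (cong (d ^_) (sym (m∸n+n≡m ℓ≤k))) (^-distribˡ-+-* d (k ∸ ℓ) ℓ)

      count-all : ∀ a → f + n + n ≤ a → countBelow ([] ∷ B) a ≡ count B
      count-all a f+n+n≤a = trans (countBelow-endblock B a)
        (countBelow-from-now a (subst (_≤ a) (cong (f + n +_) (sym p+1≡n)) f+n+n≤a))

      inc≡′ : ∀ ℓ → ℓ < k → inc (ENDBLOCK s) ℓ x ≡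
              countBelow ([] ∷ B) (f + n + n + 1) ∸ countBelow ([] ∷ B) (f + n + n + segStart (suc ℓ) 0)
      inc≡′ ℓ ℓ<k with ends (suc ℓ) p | ends-reflects (suc ℓ) p
      ... | false | ofⁿ ¬ends = ⊥-elim (¬ends (ends-every-level (suc ℓ) ℓ<k))
      ... | true  | _ =
        sym (trans (cong₂ _∸_ (count-all _ (m≤m+n _ 1)) (count-all _ (m≤m+n _ _))) (n∸n≡0 (count B)))

    endblock-preserves : Σ ℕ (λ f′ → Invariant ([] ∷ B) f′ (ENDBLOCK s))
    endblock-preserves with m≤n⇒m<n∨m≡n pos<n
    ... | inj₁ p+1<n = f , no-wrap p+1<n
    ... | inj₂ p+1≡n = f + n , wrap p+1≡n

  run-invariant : ∀ ops B f s → Invariant B f s → All Unique (foldl blockStep B ops) →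
                  Σ ℕ (λ f′ → Invariant (foldl blockStep B ops) f′ (foldl step s ops))
  run-invariant []               B       f s I _ = f , I
  run-invariant (_ ∷ ops)        []      f s I _ = ⊥-elim (no-invariant-for-[] I)
  run-invariant (add y ∷ ops)    (b ∷ B) f s I u =
    run-invariant ops ((y ∷ b) ∷ B) f (ADD s y) (add-preserves y b B f s I x-new) u
    where
    x-new : y ≡ x → mem _≟_ x b ≡ false
    x-new refl with foldl-blockStep-unique⁻ ops ((y ∷ b) ∷ B) u
    ... | (y∉b ∷ _) ∷ _ = All≢⇒mem≡false _≟_ x y∉b
  run-invariant (endblock ∷ ops) (b ∷ B) f s I u with EndBlock.endblock-preserves I
  ... | f′ , I′ = run-invariant ops ([] ∷ b ∷ B) f′ (ENDBLOCK s) I′ u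

  module Query {B f s} (I : Invariant B f s) where
    open Invariant I
    p = pos s

    C : ℕ → ℕ
    C = countBelow B

    frame now : ℕ
    frame = f + n
    now = frame + suc p

    countBeforeSeg : ℕ → ℕ → ℕ → ℕ
    countBeforeSeg base q ℓ = C (base + segStart ℓ q)

    countBeforeSeg-antitone : ∀ base q ℓ → countBeforeSeg base q (suc ℓ) ≤ countBeforeSeg base q ℓ
    countBeforeSeg-antitone base q ℓ = countBelow-mono B (+-monoʳ-≤ base (segStart-suc-≤ ℓ q))

    level-term : ∀ base q ℓ v → (0 < segIndex ℓ q % d → v ≡ table B base ℓ (segIndex ℓ q ∸ 1)) →
                 (if 1 ≤ᵇ digit ℓ q then v else 0) ≡ countBeforeSeg base q ℓ ∸ countBeforeSeg base q (suc ℓ)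
    level-term base q ℓ v v≡ with 1 ≤ᵇ digit ℓ q | ≤ᵇ-reflects-≤ 1 (digit ℓ q)
    ... | true  | ofʸ 0<digit = trans (v≡ 0<digit′) (table-preceding B base ℓ q 0<digit′)
      where 0<digit′ = subst (0 <_) (digit≡ ℓ q) 0<digit
    ... | false | ofⁿ 0≮digit = sym (begin
      C (base + segStart ℓ q) ∸ C (base + segStart (suc ℓ) q)
        ≡⟨ cong (λ a → C (base + segStart ℓ q) ∸ C (base + a)) (segStart-suc-≡ ℓ q digit≡0) ⟩
      C (base + segStart ℓ q) ∸ C (base + segStart ℓ q)
        ≡⟨ n∸n≡0 (C (base + segStart ℓ q)) ⟩
      0 ∎)
      where
      open ≡-Reasoning
      digit≡0 : segIndex ℓ q % d ≡ 0
      digit≡0 = trans (sym (digit≡ ℓ q)) (n≤0⇒n≡0 (≮⇒≥ 0≮digit))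

    sum-levels : ∀ base q (v : ℕ → ℕ) → q < n →
                 (∀ ℓ → ℓ < k → 0 < segIndex ℓ q % d → v ℓ ≡ table B base ℓ (segIndex ℓ q ∸ 1)) →
                 sumBelow k (λ ℓ → if 1 ≤ᵇ digit ℓ q then v ℓ else 0) ≡ C (base + q) ∸ C base
    sum-levels base q v q<n v≡ = begin
      sumBelow k (λ ℓ → if 1 ≤ᵇ digit ℓ q then v ℓ else 0)
        ≡⟨ sumBelow-cong k (λ ℓ ℓ<k → level-term base q ℓ (v ℓ) (v≡ ℓ ℓ<k)) ⟩
      sumBelow k (λ ℓ → countBeforeSeg base q ℓ ∸ countBeforeSeg base q (suc ℓ))
        ≡⟨ sumBelow-telescope (countBeforeSeg base q) (countBeforeSeg-antitone base q) k ⟩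
      C (base + segStart 0 q) ∸ C (base + segStart k q)
        ≡⟨ cong₂ (λ a b → C (base + a) ∸ C (base + b)) (segStart-zero q) (segStart-top q q<n) ⟩
      C (base + q) ∸ C (base + 0)
        ≡⟨ cong (λ a → C (base + q) ∸ C a) (+-identityʳ base) ⟩
      C (base + q) ∸ C base ∎
      where open ≡-Reasoning

    preceding-table-current : ∀ ℓ q → ℓ < k → 0 < segIndex ℓ q % d → segStart ℓ q ≤ p →
                              tab s ℓ (idx ℓ q) x ≡ table B frame ℓ (segIndex ℓ q ∸ 1)
    preceding-table-current ℓ q ℓ<k 0<digit start≤p rewrite idx≡ ℓ q =
      tab-current ℓ _ ℓ<k (subst (_≤ p) (sym (preceding-end ℓ q (0<segIndex ℓ q 0<digit))) start≤p)

    preceding-table-previous : ∀ ℓ q → ℓ < k → p < q → q ≤ n → 0 < segIndex ℓ q % d →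
                               (if suc (idx ℓ q) * d ^ ℓ ≤ᵇ p then ghost s ℓ x else tab s ℓ (idx ℓ q) x) ≡
                               table B f ℓ (segIndex ℓ q ∸ 1)
    preceding-table-previous ℓ q ℓ<k p<q q≤n 0<digit rewrite idx≡ ℓ q
      with suc (segIndex ℓ q ∸ 1) * d ^ ℓ ≤ᵇ p | ≤ᵇ-reflects-≤ (suc (segIndex ℓ q ∸ 1) * d ^ ℓ) p
    ... | true  | ofʸ end≤p = trans (ghost≡ ℓ ℓ<k d^ℓ≤p) (cong (λ i → table B f ℓ (i ∸ 1)) same-segment)
      where
      start≤p : segStart ℓ q ≤ p
      start≤p = subst (_≤ p) (preceding-end ℓ q (0<segIndex ℓ q 0<digit)) end≤p
      d^ℓ≤p : d ^ ℓ ≤ p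
      d^ℓ≤p = ≤-trans (subst (_≤ segStart ℓ q) (*-identityˡ (d ^ ℓ)) (*-monoˡ-≤ (d ^ ℓ) (0<segIndex ℓ q 0<digit)))
                      start≤p
      same-segment : segIndex ℓ p ≡ segIndex ℓ q
      same-segment = ≤-antisym (/-monoˡ-≤ (d ^ ℓ) {{nz ℓ}} (<⇒≤ p<q))
        (subst (_≤ segIndex ℓ p) (m*n/n≡m (segIndex ℓ q) (d ^ ℓ) {{nz ℓ}}) (/-monoˡ-≤ (d ^ ℓ) {{nz ℓ}} start≤p))
    ... | false | ofⁿ end≰p = tab-previous ℓ _ ℓ<k (≰⇒> end≰p)
      (subst (_≤ n) (sym (preceding-end ℓ q (0<segIndex ℓ q 0<digit))) (≤-trans (segStart-≤ ℓ q) q≤n))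

    cumCur≡ : ∀ q → q ≤ p → cumCur s x q ≡ C (frame + q) ∸ C frame
    cumCur≡ q q≤p = sum-levels frame q _ (≤-<-trans q≤p pos<n) λ ℓ ℓ<k 0<digit →
      preceding-table-current ℓ q ℓ<k 0<digit (≤-trans (segStart-≤ ℓ q) q≤p)

    cumPrev≡ : ∀ q → p < q → q < n → cumPrev s x q ≡ C (f + q) ∸ C f
    cumPrev≡ q p<q q<n = sum-levels f q _ q<n λ ℓ ℓ<k → preceding-table-previous ℓ q ℓ<k p<q (<⇒≤ q<n)

    module _ (0<k : 0 < k) where
      private
        k-1+1≡k : suc (k ∸ 1) ≡ k
        k-1+1≡k = trans (+-comm 1 (k ∸ 1)) (m∸n+n≡m 0<k)

      prefix≡ : prefix s x ≡ C now ∸ C frame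
      prefix≡ = begin
        inc s 0 x + sumBelow (k ∸ 1) (λ m → if 1 ≤ᵇ digit (suc m) p then tab s (suc m) (idx (suc m) p) x else 0)
          ≡⟨ cong₂ _+_ (inc≡ 0 0<k) (sumBelow-cong (k ∸ 1) upper-level) ⟩
        (C now ∸ h 1) + sumBelow (k ∸ 1) (λ m → h (suc m) ∸ h (suc (suc m)))
          ≡⟨ cong ((C now ∸ h 1) +_)
                  (sumBelow-telescope (h ∘′ suc) (λ m → countBeforeSeg-antitone frame p (suc m)) (k ∸ 1)) ⟩
        (C now ∸ h 1) + (h 1 ∸ h (suc (k ∸ 1)))
          ≡⟨ cong (λ ℓ → (C now ∸ h 1) + (h 1 ∸ h ℓ)) k-1+1≡k ⟩
        (C now ∸ h 1) + (h 1 ∸ h k)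
          ≡⟨ cong (λ a → (C now ∸ h 1) + (h 1 ∸ C a))
                  (trans (cong (frame +_) (segStart-top p pos<n)) (+-identityʳ frame)) ⟩
        (C now ∸ h 1) + (h 1 ∸ C frame)
          ≡⟨ [m∸n]+[n∸o]≡m∸o (countBelow-mono B (m≤m+n frame _))
                             (countBelow-mono B (+-monoʳ-≤ frame (≤-trans (segStart-≤ 1 p) (n≤1+n p)))) ⟩
        C now ∸ C frame ∎
        where
        open ≡-Reasoning
        h = countBeforeSeg frame p
        upper-level : ∀ m → m < k ∸ 1 →
                      (if 1 ≤ᵇ digit (suc m) p then tab s (suc m) (idx (suc m) p) x else 0) ≡ h (suc m) ∸ h (suc (suc m))
        upper-level m m<k-1 = level-term frame p (suc m) _ λ 0<digit →
          preceding-table-current (suc m) p (subst (suc m <_) k-1+1≡k (s≤s m<k-1)) 0<digit (segStart-≤ (suc m) p)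

      previous-frame : tab s (k ∸ 1) (d ∸ 1) x ≡ C frame ∸ C f
      previous-frame = trans
        (tab-previous (k ∸ 1) d-1 (subst (k ∸ 1 <_) k-1+1≡k ≤-refl)
                      (subst (p <_) (sym frame≡) pos<n) (≤-reflexive frame≡))
        (cong₂ (λ a b → C (f + a) ∸ C b) frame≡
               (trans (cong (λ i → f + i * d ^ suc (k ∸ 1)) (m<n⇒m/n≡0 {d-1} {d} ≤-refl)) (+-identityʳ f)))
        where
        frame≡ : d * d ^ (k ∸ 1) ≡ n
        frame≡ = cong (d ^_) k-1+1≡k

      window-in-frame : ∀ v → suc v ≤ suc p →
                        prefix s x ∸ cumCur s x (suc p ∸ suc v) ≡ C now ∸ C (now ∸ suc v)
      window-in-frame v v+1≤p+1 = begin
        prefix s x ∸ cumCur s x (p ∸ v)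
          ≡⟨ cong₂ _∸_ prefix≡ (cumCur≡ (p ∸ v) (m∸n≤m p v)) ⟩
        (C now ∸ C frame) ∸ (C (frame + (p ∸ v)) ∸ C frame)
          ≡⟨ [m∸o]∸[n∸o]≡m∸n (countBelow-mono B (m≤m+n frame _))
                             (countBelow-mono B (+-monoʳ-≤ frame (≤-trans (m∸n≤m p v) (n≤1+n p)))) ⟩
        C now ∸ C (frame + (p ∸ v))
          ≡⟨ cong (λ a → C now ∸ C a) (+-∸-assoc frame v+1≤p+1) ⟨
        C now ∸ C (now ∸ suc v) ∎
        where open ≡-Reasoning

      window-across-frames : ∀ v → suc p < suc v → suc v ≤ n →
                             (prefix s x + tab s (k ∸ 1) (d ∸ 1) x) ∸ cumPrev s x (n + suc p ∸ suc v) ≡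
                             C now ∸ C (now ∸ suc v)
      window-across-frames v p+1<v+1 v+1≤n = begin
        (prefix s x + tab s (k ∸ 1) (d ∸ 1) x) ∸ cumPrev s x q
          ≡⟨ cong₂ _∸_ (cong₂ _+_ prefix≡ previous-frame) (cumPrev≡ q p<q q<n) ⟩
        ((C now ∸ C frame) + (C frame ∸ C f)) ∸ (C (f + q) ∸ C f)
          ≡⟨ cong (_∸ (C (f + q) ∸ C f))
                  ([m∸n]+[n∸o]≡m∸o (countBelow-mono B (m≤m+n f n)) (countBelow-mono B (m≤m+n frame _))) ⟩
        (C now ∸ C f) ∸ (C (f + q) ∸ C f)
          ≡⟨ [m∸o]∸[n∸o]≡m∸n (countBelow-mono B (m≤m+n f q))
                             (countBelow-mono B (subst (_≤ now) (sym start≡) (m∸n≤m now (suc v)))) ⟩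
        C now ∸ C (f + q)
          ≡⟨ cong (λ a → C now ∸ C a) start≡ ⟩
        C now ∸ C (now ∸ suc v) ∎
        where
        open ≡-Reasoning
        q = n + suc p ∸ suc v
        v+1≤n+p+1 : suc v ≤ n + suc p
        v+1≤n+p+1 = ≤-trans v+1≤n (m≤m+n n (suc p))
        p<q : p < q
        p<q = m+n≤o⇒m≤o∸n (suc p) (subst (_≤ n + suc p) (+-comm (suc v) (suc p)) (+-monoˡ-≤ (suc p) v+1≤n))
        q<n : q < n
        q<n = subst (q <_) (m+n∸n≡m n (suc p)) (∸-monoʳ-< p+1<v+1 v+1≤n+p+1)
        start≡ : f + q ≡ now ∸ suc v
        start≡ = trans (sym (+-∸-assoc f v+1≤n+p+1)) (cong (_∸ suc v) (sym (+-assoc f n (suc p))))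

      WinQuery≡ : ∀ w → w ≤ n → WinQuery s x w ≡ C now ∸ C (now ∸ w)
      WinQuery≡ zero    _     = sym (n∸n≡0 (C now))
      WinQuery≡ (suc v) v+1≤n with suc v ≤ᵇ suc p | ≤ᵇ-reflects-≤ (suc v) (suc p)
      ... | true  | ofʸ v+1≤p+1 = window-in-frame v v+1≤p+1
      ... | false | ofⁿ v+1≰p+1 = window-across-frames v (≰⇒> v+1≰p+1) v+1≤n

    count-take≡ : ∀ w → w ≤ n → count (take w B) ≡ C now ∸ C (now ∸ w)
    count-take≡ w w≤n = begin
      count (take w B)
        ≡⟨ m+n∸n≡m (count (take w B)) (count (drop w B)) ⟨
      count (take w B) + count (drop w B) ∸ count (drop w B)
        ≡⟨ cong₂ _∸_ (countBlocks-take+drop _≟_ x w B)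
                     (cong (λ m → count (drop m B)) (sym (m∸[m∸n]≡n w≤all))) ⟩
      count B ∸ C (length B + n ∸ w)
        ≡⟨ cong₂ (λ a b → a ∸ C (b ∸ w)) (sym (countBelow-from-now now ≤-refl)) now≡ ⟩
      C now ∸ C (now ∸ w) ∎
      where
      open ≡-Reasoning
      w≤all : w ≤ length B + n
      w≤all = ≤-trans w≤n (m≤n+m n (length B))

  module _ (0<k : 0 < k) (ops : List (Op U)) (unique : All Unique (blocks ops)) where
    private
      reachable : Σ ℕ (λ f → Invariant (blocks ops) f (run ops))
      reachable = run-invariant ops ([] ∷ []) 0 init initial unique

    WinQuery-correct : ∀ w → w ≤ n → WinQuery (run ops) x w ≡ g _≟_ x w ops
    WinQuery-correct w w≤n = trans (WinQuery≡ 0<k w w≤n) (sym (count-take≡ w w≤n))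
      where open Query (proj₂ reachable)

    BlockIntervalQuery-correct : ∀ i j → i ≤ j → j ≤ n →
                                 BlockIntervalQuery (run ops) x i j ≡ gInt _≟_ x i j ops
    BlockIntervalQuery-correct zero    j _   j≤n = WinQuery-correct j j≤n
    BlockIntervalQuery-correct (suc i) j i≤j j≤n =
      cong₂ _∸_ (WinQuery-correct j j≤n) (WinQuery-correct (suc i) (≤-trans i≤j j≤n))

theorem4 : (U : Set) (_≟_ : DecidableEquality U) (n k d : ℕ) →
    1 ≤ n → 1 ≤ k → d ^ k ≡ n →
    (ops : List (Op U)) → All Unique (blocks ops) →
    (x : U) (i j : ℕ) → i ≤ j → j ≤ n →
    ACC.BlockIntervalQuery _≟_ d k (ACC.run _≟_ d k ops) x i j ≡ gInt _≟_ x i j ops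
theorem4 U _≟_ .(zero ^ suc k) (suc k) zero () _ refl
theorem4 U _≟_ .(suc d-1 ^ k) k (suc d-1) _ 0<k refl ops unique x =
  Correctness.BlockIntervalQuery-correct _≟_ d-1 k x 0<k ops unique
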